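{- Let $H$ and $G$ be finite simple graphs, let $\phi:V(H)\to V(G)$ be a folding of $H$ into $G$, and let $A\subseteq V(G)$ be homogeneous in $G$. Then $\phi^{ -1}(A)$ is homogeneous in $H$. In particular, if $H$ is prime, then either $\phi$ is trivial, or $\phi$ is injective, and thus is a strong homomorphism.
   Context: A map $\phi:V(G)\to V(H)$ is a folding of $G$ into $H$ if for every pair of vertices $u,v\in V(G)$, either $\phi(u)=\phi(v)$, or ($uv\in E(G)$ if and only if $\phi(u)\phi(v)\in E(H)$). A folding is trivial if it maps all vertices to a single vertex. A map $\phi:V(F)\to V(G)$ is a strong homomorphism if $vw\in E(F)$ if and only if $\phi(v)\phi(w)\in E(G)$ (for all $v,w$; in particular graphs have no loops). A set $A\subseteq V(H)$ is homogeneous in $H$ if for every pair of distinct $u,v\in A$, $N(u)\setminus A=N(v)\setminus A$, where $N(\cdot)$ denotes the neighbourhood. A graph $H$ is prime if it contains no homogeneous set $A$ with $1<|A|\le |V(H)|-1$. -}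

module Defs where

open import Data.Nat using (ℕ; _<_; _≤_; _∸_)
open import Data.Fin using (Fin)
open import Data.Fin.Subset using (Subset; _∈_; _∉_; ∣_∣)
open import Data.Vec using (tabulate; lookup)
open import Data.Product using (_×_; ∃)
open import Data.Sum using (_⊎_)
open import Data.Empty using (⊥)
open import Relation.Nullary using (¬_)
open import Relation.Binary.PropositionalEquality using (_≡_)
open import Function.Bundles using (_⇔_)
open import Level using (0ℓ; suc)

record Graph (n : ℕ) : Set₁ where
  field
    Adj   : Fin n → Fin n → Set
    sym   : ∀ {u v} → Adj u v → Adj v u
    irrefl : ∀ {u} → ¬ Adj u u
open Graph public

IsFolding : ∀ {m n} → Graph m → Graph n → (Fin m → Fin n) → Set
IsFolding G H φ = ∀ u v → (φ u ≡ φ v) ⊎ (Adj G u v ⇔ Adj H (φ u) (φ v))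

IsTrivial : ∀ {m n} → (Fin m → Fin n) → Set
IsTrivial φ = ∃ λ c → ∀ x → φ x ≡ c

IsInjective : ∀ {m n} → (Fin m → Fin n) → Set
IsInjective φ = ∀ x y → φ x ≡ φ y → x ≡ y

IsStrongHom : ∀ {m n} → Graph m → Graph n → (Fin m → Fin n) → Set
IsStrongHom F G φ = ∀ v w → Adj F v w ⇔ Adj G (φ v) (φ w)

IsHomogeneous : ∀ {n} → Graph n → Subset n → Set
IsHomogeneous H A = ∀ u v → u ∈ A → v ∈ A → ¬ u ≡ v →
  ∀ w → w ∉ A → (Adj H u w ⇔ Adj H v w)

preimage : ∀ {m n} → (Fin m → Fin n) → Subset n → Subset m
preimage φ A = tabulate (λ x → lookup A (φ x))

IsPrime : ∀ {n} → Graph n → Set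
IsPrime {n} H = ∀ (A : Subset n) → IsHomogeneous H A → 1 < ∣ A ∣ → ∣ A ∣ ≤ n ∸ 1 → ⊥

-- A folding preserves adjacency between vertices with distinct images, so
-- adjacency from a vertex of φ⁻¹(A) to a vertex outside it is read off in G,
-- where it does not depend on the chosen vertex of A. Applied to a singleton A,
-- every fibre of φ is homogeneous; in a prime graph a fibre with two vertices
-- is therefore the whole vertex set, so φ is either injective or constant.
module Submission where

open import Defs hiding (sym)
open import Data.Nat using (_<_; _≤_; _∸_)
open import Data.Nat.Properties using (∸-monoˡ-≤)
open import Data.Fin using (Fin; _≟_)
open import Data.Fin.Properties using (all?; ¬∀⟶∃¬)
open import Data.Fin.Subset using (Subset; ⁅_⁆; _∈_; _∉_; ∣_∣)
open import Data.Fin.Subset.Properties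
  using (_∈?_; x∈⁅y⁆⇒x≡y; x∈⁅x⁆; ∈⊤; ∣⊤∣≡n; ∣⁅x⁆∣≡1; p⊂q⇒∣p∣<∣q∣)
open import Data.Vec.Properties using (lookup∘tabulate; []=⇒lookup; lookup⇒[]=)
open import Data.Product using (_×_; _,_; ∃₂)
open import Data.Sum using (_⊎_; inj₁; inj₂)
open import Data.Empty using (⊥-elim)
open import Relation.Nullary using (Dec; yes; no; contradiction)
open import Relation.Nullary.Decidable using (_→-dec_; decidable-stable)
open import Relation.Binary.PropositionalEquality
  using (_≡_; _≢_; refl; sym; trans; subst)
open import Function.Bundles using (_⇔_; mk⇔)
import Function.Properties.Equivalence as ⇔

module _ {m n} {φ : Fin m → Fin n} {A : Subset n} {x : Fin m} where

  ∈-preimage⁺ : φ x ∈ A → x ∈ preimage φ A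
  ∈-preimage⁺ φx∈A = lookup⇒[]= x _
    (trans (lookup∘tabulate _ x) ([]=⇒lookup φx∈A))

  ∈-preimage⁻ : x ∈ preimage φ A → φ x ∈ A
  ∈-preimage⁻ x∈φ⁻¹A = lookup⇒[]= (φ x) A
    (trans (sym (lookup∘tabulate _ x)) ([]=⇒lookup x∈φ⁻¹A))

1<∣p∣ : ∀ {n} {p : Subset n} {x y} → x ∈ p → y ∈ p → x ≢ y → 1 < ∣ p ∣
1<∣p∣ {p = p} {x} {y} x∈p y∈p x≢y =
  subst (_< ∣ p ∣) (∣⁅x⁆∣≡1 x) (p⊂q⇒∣p∣<∣q∣ (⁅x⁆⊆p , y , y∈p , y∉⁅x⁆))
  where
  ⁅x⁆⊆p : ∀ {z} → z ∈ ⁅ x ⁆ → z ∈ p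
  ⁅x⁆⊆p z∈⁅x⁆ = subst (_∈ p) (sym (x∈⁅y⁆⇒x≡y x z∈⁅x⁆)) x∈p

  y∉⁅x⁆ : y ∉ ⁅ x ⁆
  y∉⁅x⁆ y∈⁅x⁆ = x≢y (sym (x∈⁅y⁆⇒x≡y x y∈⁅x⁆))

∣p∣≤n∸1 : ∀ {n} {p : Subset n} {z} → z ∉ p → ∣ p ∣ ≤ n ∸ 1
∣p∣≤n∸1 {n} {p} z∉p = ∸-monoˡ-≤ 1
  (subst (∣ p ∣ <_) (∣⊤∣≡n n) (p⊂q⇒∣p∣<∣q∣ ((λ _ → ∈⊤) , _ , ∈⊤ , z∉p)))

injectiveAt? : ∀ {m n} (f : Fin m → Fin n) x y → Dec (f x ≡ f y → x ≡ y)
injectiveAt? f x y = (f x ≟ f y) →-dec (x ≟ y)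

injective⊎collision : ∀ {m n} (f : Fin m → Fin n) →
  IsInjective f ⊎ ∃₂ λ x y → x ≢ y × f x ≡ f y
injective⊎collision {m} f with all? (λ x → all? (injectiveAt? f x))
... | yes injective = inj₁ injective
... | no ¬injective with ¬∀⟶∃¬ m _ (λ x → all? (injectiveAt? f x)) ¬injective
... | x , ¬injectiveAt-x with ¬∀⟶∃¬ m _ (injectiveAt? f x) ¬injectiveAt-x
... | y , ¬injectiveAt-xy = inj₂ (x , y , x≢y , fx≡fy)
  where
  x≢y : x ≢ y
  x≢y x≡y = ¬injectiveAt-xy (λ _ → x≡y)

  fx≡fy : f x ≡ f y
  fx≡fy = decidable-stable (f x ≟ f y)
    (λ fx≢fy → ¬injectiveAt-xy (λ fx≡fy → contradiction fx≡fy fx≢fy))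

homogeneous-adj : ∀ {n} {G : Graph n} {A : Subset n} → IsHomogeneous G A →
  ∀ {u v w} → u ∈ A → v ∈ A → w ∉ A → Adj G u w ⇔ Adj G v w
homogeneous-adj hom {u} {v} {w} u∈A v∈A w∉A with u ≟ v
... | yes refl = ⇔.refl
... | no u≢v = hom u v u∈A v∈A u≢v w w∉A

singleton-homogeneous : ∀ {n} (G : Graph n) c → IsHomogeneous G ⁅ c ⁆
singleton-homogeneous G c u v u∈⁅c⁆ v∈⁅c⁆ u≢v =
  contradiction (trans (x∈⁅y⁆⇒x≡y c u∈⁅c⁆) (sym (x∈⁅y⁆⇒x≡y c v∈⁅c⁆))) u≢v

prime⇒homogeneous-full : ∀ {n} {H : Graph n} {A : Subset n} → IsPrime H →
  IsHomogeneous H A → ∀ {x y} → x ∈ A → y ∈ A → x ≢ y → ∀ z → z ∈ A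
prime⇒homogeneous-full {A = A} prime hom x∈A y∈A x≢y z with z ∈? A
... | yes z∈A = z∈A
... | no z∉A = ⊥-elim (prime A hom (1<∣p∣ x∈A y∈A x≢y) (∣p∣≤n∸1 z∉A))

module _ {m n} {H : Graph m} {G : Graph n} {φ : Fin m → Fin n}
         (folding : IsFolding H G φ) where

  folding-adj : ∀ {u v} → φ u ≢ φ v → Adj H u v ⇔ Adj G (φ u) (φ v)
  folding-adj {u} {v} φu≢φv with folding u v
  ... | inj₁ φu≡φv = contradiction φu≡φv φu≢φv
  ... | inj₂ adj⇔adj = adj⇔adj

  folding-preimage-homogeneous : ∀ {A} → IsHomogeneous G A →
    IsHomogeneous H (preimage φ A)
  folding-preimage-homogeneous {A} hom u v u∈φ⁻¹A v∈φ⁻¹A _ w w∉φ⁻¹A =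
    ⇔.trans (folding-adj (image-≢ u∈φ⁻¹A))
      (⇔.trans (homogeneous-adj {G = G} hom (∈-preimage⁻ u∈φ⁻¹A) (∈-preimage⁻ v∈φ⁻¹A) φw∉A)
        (⇔.sym (folding-adj (image-≢ v∈φ⁻¹A))))
    where
    φw∉A : φ w ∉ A
    φw∉A φw∈A = w∉φ⁻¹A (∈-preimage⁺ φw∈A)

    image-≢ : ∀ {x} → x ∈ preimage φ A → φ x ≢ φ w
    image-≢ x∈φ⁻¹A φx≡φw = φw∉A (subst (_∈ A) φx≡φw (∈-preimage⁻ x∈φ⁻¹A))

  injective-folding⇒strongHom : IsInjective φ → IsStrongHom H G φ
  injective-folding⇒strongHom injective v w with v ≟ w
  ... | yes refl = mk⇔ (λ vv → ⊥-elim (irrefl H vv)) (λ φvφv → ⊥-elim (irrefl G φvφv))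
  ... | no v≢w = folding-adj (λ φv≡φw → v≢w (injective v w φv≡φw))

  prime-folding⇒trivial⊎injective : IsPrime H →
    IsTrivial φ ⊎ (IsInjective φ × IsStrongHom H G φ)
  prime-folding⇒trivial⊎injective prime with injective⊎collision φ
  ... | inj₁ injective = inj₂ (injective , injective-folding⇒strongHom injective)
  ... | inj₂ (x , y , x≢y , φx≡φy) = inj₁ (φ x , φ-constant)
    where
    fibre-full : ∀ z → z ∈ preimage φ ⁅ φ x ⁆
    fibre-full = prime⇒homogeneous-full {H = H} prime
      (folding-preimage-homogeneous (singleton-homogeneous G (φ x)))
      (∈-preimage⁺ (x∈⁅x⁆ (φ x)))
      (∈-preimage⁺ (subst (_∈ ⁅ φ x ⁆) φx≡φy (x∈⁅x⁆ (φ x))))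
      x≢y

    φ-constant : ∀ z → φ z ≡ φ x
    φ-constant z = x∈⁅y⁆⇒x≡y (φ x) (∈-preimage⁻ (fibre-full z))

proposition3p1 : ∀ {m n} (H : Graph m) (G : Graph n) (φ : Fin m → Fin n) →
    IsFolding H G φ →
    ((A : Subset n) → IsHomogeneous G A → IsHomogeneous H (preimage φ A))
    × (IsPrime H → IsTrivial φ ⊎ (IsInjective φ × IsStrongHom H G φ))
proposition3p1 H G φ folding =
  (λ A → folding-preimage-homogeneous {H = H} {G = G} folding {A}) ,
  prime-folding⇒trivial⊎injective {H = H} {G = G} folding
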